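{- Let $G$ be a finite simple graph with minimum degree $\delta$, let $C$ be a longest cycle in $G$, and let $P = x\overrightarrow{P}y$ be a longest path in $G \setminus C$, of length $\bar p \geq 1$. Suppose $|N_C(x)| \geq 2$, $|N_C(y)| \geq 2$ and $N_C(x) \neq N_C(y)$. Put $\sigma_1 = |N_C(x) \setminus N_C(y)|$ and $\sigma_2 = |N_C(y) \setminus N_C(x)|$. Then $$|C| \geq 3\delta + \max\{\sigma_1,\sigma_2\} - 1 \geq 3\delta \quad \text{if } \bar p = 1,$$ and $$|C| \geq \max\{2\bar p + 8,\; 4\delta - 2\bar p\} \quad \text{if } \bar p \geq 2.$$
   Context: Graphs are finite, undirected, without loops or multiple edges. The length $|Q|$ of a path or cycle $Q$ is its number of edges. $G\setminus C$ denotes the subgraph of $G$ induced by $V(G)\setminus V(C)$. For a vertex $v$, $N(v)$ is its neighborhood and $N_C(v) = N(v) \cap V(C)$. -}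

module Defs where

open import Data.Nat using (ℕ; zero; suc; _+_; _≤_)
open import Data.Fin using (Fin)
open import Data.Bool using (Bool; true; false; if_then_else_)
open import Data.List using (List; []; _∷_; allFin)
open import Data.List.Relation.Unary.Unique.Propositional using (Unique)
open import Data.List.Membership.Propositional using (_∉_)
open import Data.List.Relation.Unary.All using (All)
open import Data.Unit using (⊤)
open import Data.Empty using (⊥)
open import Data.Product using (_×_; ∃)
open import Relation.Binary.PropositionalEquality using (_≡_)

record Graph (n : ℕ) : Set where
  field
    adj    : Fin n → Fin n → Bool
    sym    : ∀ u v → adj u v ≡ adj v u
    irrefl : ∀ v → adj v v ≡ false
open Graph public

Edge : ∀ {n} → Graph n → Fin n → Fin n → Set
Edge G u v = adj G u v ≡ true

countB : ∀ {n} → (Fin n → Bool) → List (Fin n) → ℕ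
countB p []       = 0
countB p (v ∷ vs) = if p v then suc (countB p vs) else countB p vs

deg : ∀ {n} → Graph n → Fin n → ℕ
deg {n} G v = countB (adj G v) (allFin n)

IsMinDegree : ∀ {n} → Graph n → ℕ → Set
IsMinDegree {n} G δ = (∀ v → δ ≤ deg G v) × ∃ λ v → deg G v ≡ δ

Chain : ∀ {n} → Graph n → List (Fin n) → Set
Chain G []           = ⊤
Chain G (_ ∷ [])     = ⊤
Chain G (u ∷ v ∷ vs) = Edge G u v × Chain G (v ∷ vs)

lastOf : ∀ {n} → Fin n → List (Fin n) → Fin n
lastOf v []       = v
lastOf v (w ∷ ws) = lastOf w ws

Closed : ∀ {n} → Graph n → List (Fin n) → Set
Closed G []       = ⊥
Closed G (v ∷ vs) = Edge G (lastOf v vs) v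

-- a cycle given by its vertex sequence v₀ … v_{k-1}; its length |C| is k
IsCycle : ∀ {n} → Graph n → List (Fin n) → Set
IsCycle G vs = 3 ≤ Data.List.length vs × Unique vs × Chain G vs × Closed G vs

-- a path given by its (non-empty) vertex sequence; its length is #vertices − 1
IsPath : ∀ {n} → Graph n → List (Fin n) → Set
IsPath G []       = ⊥
IsPath G (v ∷ vs) = Unique (v ∷ vs) × Chain G (v ∷ vs)

IsPathOutside : ∀ {n} → Graph n → List (Fin n) → List (Fin n) → Set
IsPathOutside G C vs = IsPath G vs × All (_∉ C) vs

-- Let u₀, u₁, …, u₀ be the neighbours of x or y on C in cyclic order. Since C is longest, the arc of C
-- between consecutive uᵢ, uᵢ₊₁ is no shorter than a detour replacing it: it has length ≥ 2, and ≥ p̄ + 2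
-- when one of them is adjacent to x and the other to y, as then P itself is a detour. Each common
-- neighbour of x and y ends such a crossing pair, and so does every entry of the cyclic sequence into
-- N_C(x) ∖ N_C(y) or into N_C(y) ∖ N_C(x); if σᵢ ≥ 1 there is at least one such entry, because the other
-- endpoint has a neighbour on C too. Hence, with s = |N_C(x) ∩ N_C(y)| and tᵢ the numbers of entries,
--   |C| ≥ 2(s + σ₁ + σ₂) + p̄ (s + t₁ + t₂).
-- As P is a longest path of G ∖ C, the neighbours of its ends lie on C ∪ P, so δ ≤ s + σᵢ + p̄, and the
-- bounds follow by linear arithmetic.

module Submission where

open import Defs hiding (sym)
open import Data.Nat using (ℕ; zero; suc; _+_; _*_; _∸_; _≤_; _⊔_; z≤n; s≤s; s≤s⁻¹)
open import Data.Nat.Properties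
open import Data.Nat.Solver using (module +-*-Solver)
open +-*-Solver using (solve; _:+_; _:*_; _:=_; con)
open import Algebra.Properties.CommutativeSemigroup +-commutativeSemigroup using (interchange; x∙yz≈y∙xz; xy∙z≈xz∙y)
open import Data.Fin using (Fin)
import Data.Fin as Fin
open import Data.Bool using (Bool; true; false; T; _∧_; _∨_; not)
open import Data.Bool.Properties using (∧-comm; ∧-zeroʳ; ∨-zeroʳ)
open import Data.List using (List; []; _∷_; length; _++_; filterᵇ; allFin; [_])
open import Data.List.Properties using (length-++; ++-assoc; ++-identityʳ)
open import Data.List.Membership.Propositional using (_∈_; _∉_; find)
open import Data.List.Membership.Propositional.Properties using (∈-++⁺ˡ; ∈-++⁺ʳ; ∈-++⁻; ∈-∃++; ∈-filter⁺)
open import Data.List.Relation.Unary.Any using (Any; here; there; _─_)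
open import Data.List.Relation.Unary.All using (All; []; _∷_; lookup)
import Data.List.Relation.Unary.All as All
import Data.List.Relation.Unary.All.Properties as All
open import Data.List.Relation.Unary.AllPairs using ([]; _∷_)
open import Data.List.Relation.Unary.Unique.Propositional using (Unique)
import Data.List.Relation.Unary.Unique.Propositional.Properties as Unique
open import Data.Product using (_×_; _,_; proj₁; proj₂; ∃; ∃₂; swap)
open import Data.Sum using (_⊎_; inj₁; inj₂; [_,_]′)
open import Data.Empty using (⊥-elim)
open import Data.Unit using (tt)
open import Function using (_∘_; case_of_)
open import Relation.Nullary using (¬_; yes; no)
open import Relation.Nullary.Decidable using (T?)
open import Relation.Binary.PropositionalEquality hiding ([_])

boolToℕ : Bool → ℕ
boolToℕ true  = 1
boolToℕ false = 0

∨-∧-cases : ∀ a b c d → (a ∧ b) ∨ (c ∧ d) ≡ true → (a ≡ true × b ≡ true) ⊎ (c ≡ true × d ≡ true)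
∨-∧-cases true  true  _     _     _  = inj₁ (refl , refl)
∨-∧-cases true  false true  true  _  = inj₂ (refl , refl)
∨-∧-cases false _     true  true  _  = inj₂ (refl , refl)
∨-∧-cases true  false true  false ()
∨-∧-cases true  false false _     ()
∨-∧-cases false _     true  false ()
∨-∧-cases false _     false _     ()

∨-pair-cases : ∀ a b c d → a ∨ b ≡ true → c ∨ d ≡ true →
  (a ≡ true × c ≡ true) ⊎ (b ≡ true × d ≡ true) ⊎ ((a ∧ d) ∨ (b ∧ c) ≡ true)
∨-pair-cases true  _     true  _     _  _  = inj₁ (refl , refl)
∨-pair-cases true  _     false true  _  _  = inj₂ (inj₂ refl)
∨-pair-cases false true  true  _     _  _  = inj₂ (inj₂ refl)
∨-pair-cases false true  false true  _  _  = inj₂ (inj₁ (refl , refl))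
∨-pair-cases true  _     false false _  ()
∨-pair-cases false false _     _     () _
∨-pair-cases false true  false false _  ()

boolToℕ-∧-split : ∀ a b → boolToℕ a ≡ boolToℕ (a ∧ b) + boolToℕ (a ∧ not b)
boolToℕ-∧-split true  true  = refl
boolToℕ-∧-split true  false = refl
boolToℕ-∧-split false _     = refl

boolToℕ-∨-split : ∀ a b → boolToℕ (a ∨ b) ≡ boolToℕ a + boolToℕ (b ∧ not a)
boolToℕ-∨-split true  true  = refl
boolToℕ-∨-split true  false = refl
boolToℕ-∨-split false true  = refl
boolToℕ-∨-split false false = refl

∧-not-false⇒≡ : ∀ a b → a ∧ not b ≡ false → b ∧ not a ≡ false → a ≡ b
∧-not-false⇒≡ true  true  _  _  = refl
∧-not-false⇒≡ false false _  _  = refl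
∧-not-false⇒≡ true  false () _
∧-not-false⇒≡ false true  _  ()

∧≡true⇒ˡ : ∀ a {b} → a ∧ b ≡ true → a ≡ true
∧≡true⇒ˡ true _ = refl

-- Given a ∨ b, the three indicators on the left are mutually exclusive and each one forces the right-hand side.
entry-indicators≤crossing : ∀ a b c d → a ∨ b ≡ true →
  boolToℕ (c ∧ d) + (boolToℕ (not (a ∧ not b) ∧ (c ∧ not d)) + boolToℕ (not (b ∧ not a) ∧ (d ∧ not c)))
  ≤ boolToℕ ((a ∧ d) ∨ (b ∧ c))
entry-indicators≤crossing true  true  true  true  _ = ≤ᵇ⇒≤ _ _ tt
entry-indicators≤crossing true  true  true  false _ = ≤ᵇ⇒≤ _ _ tt
entry-indicators≤crossing true  true  false true  _ = ≤ᵇ⇒≤ _ _ tt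
entry-indicators≤crossing true  true  false false _ = ≤ᵇ⇒≤ _ _ tt
entry-indicators≤crossing true  false true  true  _ = ≤ᵇ⇒≤ _ _ tt
entry-indicators≤crossing true  false true  false _ = ≤ᵇ⇒≤ _ _ tt
entry-indicators≤crossing true  false false true  _ = ≤ᵇ⇒≤ _ _ tt
entry-indicators≤crossing true  false false false _ = ≤ᵇ⇒≤ _ _ tt
entry-indicators≤crossing false true  true  true  _ = ≤ᵇ⇒≤ _ _ tt
entry-indicators≤crossing false true  true  false _ = ≤ᵇ⇒≤ _ _ tt
entry-indicators≤crossing false true  false true  _ = ≤ᵇ⇒≤ _ _ tt
entry-indicators≤crossing false true  false false _ = ≤ᵇ⇒≤ _ _ tt
entry-indicators≤crossing false false _     _     ()

filterᵇ-All : ∀ {A : Set} (p : A → Bool) xs → All (λ v → p v ≡ true) (filterᵇ p xs)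
filterᵇ-All p []       = []
filterᵇ-All p (v ∷ xs) with p v in pv
... | true  = pv ∷ filterᵇ-All p xs
... | false = filterᵇ-All p xs

∈-filterᵇ⁺ : ∀ {A : Set} (p : A → Bool) {v xs} → v ∈ xs → p v ≡ true → v ∈ filterᵇ p xs
∈-filterᵇ⁺ p v∈ pv = ∈-filter⁺ (T? ∘ p) v∈ (subst T (sym pv) tt)

module _ {n : ℕ} where

  countB-∷ : ∀ (p : Fin n → Bool) v xs → countB p (v ∷ xs) ≡ boolToℕ (p v) + countB p xs
  countB-∷ p v xs with p v
  ... | true  = refl
  ... | false = refl

  countB-++ : ∀ (p : Fin n → Bool) xs ys → countB p (xs ++ ys) ≡ countB p xs + countB p ys
  countB-++ p []       ys = refl
  countB-++ p (v ∷ xs) ys with p v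
  ... | true  = cong suc (countB-++ p xs ys)
  ... | false = countB-++ p xs ys

  countB-rotate : ∀ (p : Fin n → Bool) xs ys → countB p (ys ++ xs) ≡ countB p (xs ++ ys)
  countB-rotate p xs ys = begin
    countB p (ys ++ xs)           ≡⟨ countB-++ p ys xs ⟩
    countB p ys + countB p xs     ≡⟨ +-comm (countB p ys) _ ⟩
    countB p xs + countB p ys     ≡⟨ countB-++ p xs ys ⟨
    countB p (xs ++ ys)           ∎
    where open ≡-Reasoning

  countB≤length : ∀ (p : Fin n → Bool) xs → countB p xs ≤ length xs
  countB≤length p []       = z≤n
  countB≤length p (v ∷ xs) with p v
  ... | true  = s≤s (countB≤length p xs)
  ... | false = m≤n⇒m≤1+n (countB≤length p xs)

  countB-all : ∀ (p : Fin n → Bool) xs → All (λ v → p v ≡ true) xs → countB p xs ≡ length xs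
  countB-all p []       []        = refl
  countB-all p (v ∷ xs) (pv ∷ ps) rewrite pv = cong suc (countB-all p xs ps)

  countB-split : ∀ (f g h : Fin n → Bool) → (∀ v → boolToℕ (f v) ≡ boolToℕ (g v) + boolToℕ (h v)) →
                 ∀ xs → countB f xs ≡ countB g xs + countB h xs
  countB-split f g h split []       = refl
  countB-split f g h split (v ∷ xs) = begin
    countB f (v ∷ xs)
      ≡⟨ countB-∷ f v xs ⟩
    boolToℕ (f v) + countB f xs
      ≡⟨ cong₂ _+_ (split v) (countB-split f g h split xs) ⟩
    (boolToℕ (g v) + boolToℕ (h v)) + (countB g xs + countB h xs)
      ≡⟨ interchange (boolToℕ (g v)) _ _ _ ⟩
    (boolToℕ (g v) + countB g xs) + (boolToℕ (h v) + countB h xs)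
      ≡⟨ cong₂ _+_ (countB-∷ g v xs) (countB-∷ h v xs) ⟨
    countB g (v ∷ xs) + countB h (v ∷ xs) ∎
    where open ≡-Reasoning

  countB-filterᵇ : ∀ (q p : Fin n → Bool) → (∀ {v} → q v ≡ true → p v ≡ true) →
                   ∀ xs → countB q (filterᵇ p xs) ≡ countB q xs
  countB-filterᵇ q p q⇒p []       = refl
  countB-filterᵇ q p q⇒p (v ∷ xs) with p v in pv
  ... | true  = trans (countB-∷ q v (filterᵇ p xs))
                  (trans (cong (boolToℕ (q v) +_) (countB-filterᵇ q p q⇒p xs)) (sym (countB-∷ q v xs)))
  ... | false with q v in qv
  ...   | true  = case trans (sym (q⇒p qv)) pv of λ ()
  ...   | false = countB-filterᵇ q p q⇒p xs

  countB-witness : ∀ (p : Fin n → Bool) xs → 1 ≤ countB p xs → Any (λ v → p v ≡ true) xs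
  countB-witness p (v ∷ xs) pos with p v in pv
  ... | true  = here pv
  ... | false = there (countB-witness p xs pos)

  countB≡0⇒false : ∀ (p : Fin n → Bool) xs → countB p xs ≡ 0 → ∀ {v} → v ∈ xs → p v ≡ false
  countB≡0⇒false p (w ∷ xs) none v∈ with p w in pw | v∈
  ... | false | here refl  = pw
  ... | false | there v∈xs = countB≡0⇒false p xs none v∈xs

  countB-─ : ∀ (p : Fin n → Bool) xs {v} (v∈ : v ∈ xs) → countB p xs ≡ boolToℕ (p v) + countB p (xs ─ v∈)
  countB-─ p (w ∷ xs) (here refl) = countB-∷ p w xs
  countB-─ p (w ∷ xs) {v} (there v∈) = begin
    countB p (w ∷ xs)                                  ≡⟨ countB-∷ p w xs ⟩
    boolToℕ (p w) + countB p xs                        ≡⟨ cong (boolToℕ (p w) +_) (countB-─ p xs v∈) ⟩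
    boolToℕ (p w) + (boolToℕ (p v) + countB p (xs ─ v∈)) ≡⟨ x∙yz≈y∙xz (boolToℕ (p w)) (boolToℕ (p v)) _ ⟩
    boolToℕ (p v) + (boolToℕ (p w) + countB p (xs ─ v∈)) ≡⟨ cong (boolToℕ (p v) +_) (countB-∷ p w (xs ─ v∈)) ⟨
    boolToℕ (p v) + countB p (w ∷ xs ─ there v∈)         ∎
    where open ≡-Reasoning

  ∈-─ : ∀ xs {v w : Fin n} (v∈ : v ∈ xs) → w ∈ xs → w ≢ v → w ∈ (xs ─ v∈)
  ∈-─ (_ ∷ xs) (here refl) (here refl) w≢v = ⊥-elim (w≢v refl)
  ∈-─ (_ ∷ xs) (here refl) (there w∈)  _   = w∈
  ∈-─ (_ ∷ xs) (there v∈)  (here refl) _   = here refl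
  ∈-─ (_ ∷ xs) (there v∈)  (there w∈)  w≢v = there (∈-─ xs v∈ w∈ w≢v)

  countB-mono : ∀ (p : Fin n → Bool) xs ys → Unique xs → (∀ {v} → v ∈ xs → p v ≡ true → v ∈ ys) →
                countB p xs ≤ countB p ys
  countB-mono p []       ys _          _   = z≤n
  countB-mono p (v ∷ xs) ys (v∉xs ∷ u) sub with p v in pv
  ... | false = countB-mono p xs ys u (sub ∘ there)
  ... | true  = subst (suc (countB p xs) ≤_) (sym ys-count)
                  (s≤s (countB-mono p xs (ys ─ v∈ys) u sub-removed))
    where
    v∈ys : v ∈ ys
    v∈ys = sub (here refl) pv
    ys-count : countB p ys ≡ suc (countB p (ys ─ v∈ys))
    ys-count = trans (countB-─ p ys v∈ys) (cong (λ b → boolToℕ b + countB p (ys ─ v∈ys)) pv)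
    sub-removed : ∀ {w} → w ∈ xs → p w ≡ true → w ∈ (ys ─ v∈ys)
    sub-removed w∈ pw = ∈-─ ys v∈ys (sub (there w∈) pw) (λ w≡v → lookup v∉xs w∈ (sym w≡v))

module _ {A : Set} where

  Unique-++⁻ : ∀ (xs : List A) {ys} → Unique (xs ++ ys) → Unique xs × Unique ys × (∀ {z} → z ∈ xs → z ∉ ys)
  Unique-++⁻ []       u         = [] , u , λ ()
  Unique-++⁻ (x ∷ xs) (x∉ ∷ u) with Unique-++⁻ xs u
  ... | uxs , uys , disjoint = (All.++⁻ˡ xs x∉ ∷ uxs) , uys , λ where
    (here refl) z∈ys → lookup (All.++⁻ʳ xs x∉) z∈ys refl
    (there z∈xs)     → disjoint z∈xs

  Unique-rotate : ∀ (xs ys : List A) → Unique (xs ++ ys) → Unique (ys ++ xs)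
  Unique-rotate xs ys u with Unique-++⁻ xs u
  ... | uxs , uys , disjoint = Unique.++⁺ uys uxs (λ (z∈ys , z∈xs) → disjoint z∈xs z∈ys)

  ∈-rotate : ∀ (xs ys : List A) {z} → z ∈ ys ++ xs → z ∈ xs ++ ys
  ∈-rotate xs ys z∈ with ∈-++⁻ ys z∈
  ... | inj₁ z∈ys = ∈-++⁺ʳ xs z∈ys
  ... | inj₂ z∈xs = ∈-++⁺ˡ z∈xs

  length-rotate : ∀ (xs ys : List A) → length (ys ++ xs) ≡ length (xs ++ ys)
  length-rotate xs ys = trans (length-++ ys) (trans (+-comm (length ys) _) (sym (length-++ xs)))

  adjacentSum : (A → A → ℕ) → List A → ℕ
  adjacentSum f []           = 0
  adjacentSum f (z ∷ [])     = 0
  adjacentSum f (z ∷ z′ ∷ L) = f z z′ + adjacentSum f (z′ ∷ L)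

  entries : (A → Bool) → List A → ℕ
  entries q []           = 0
  entries q (z ∷ [])     = 0
  entries q (z ∷ z′ ∷ L) = boolToℕ (not (q z) ∧ q z′) + entries q (z′ ∷ L)

  entries-∷ : ∀ q z L → entries q L ≤ entries q (z ∷ L)
  entries-∷ q z []       = z≤n
  entries-∷ q z (z′ ∷ L) = m≤n+m _ _

  entries-++ : ∀ q pre L → entries q L ≤ entries q (pre ++ L)
  entries-++ q []        L = ≤-refl
  entries-++ q (z ∷ pre) L = ≤-trans (entries-++ q pre L) (entries-∷ q z (pre ++ L))

  entries-from-outside : ∀ q {z w} L → q z ≡ false → w ∈ L → q w ≡ true → 1 ≤ entries q (z ∷ L)
  entries-from-outside q {z} (z′ ∷ L) qz w∈ qw with q z′ in qz′ | w∈
  ... | true  | _          rewrite qz = s≤s z≤n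
  ... | false | here refl  = case trans (sym qw) qz′ of λ ()
  ... | false | there w∈L  = ≤-trans (entries-from-outside q L qz′ w∈L qw) (m≤n+m _ _)

  closed-walk-entries : ∀ q u₀ M {v w} → v ∈ u₀ ∷ M → q v ≡ true → w ∈ u₀ ∷ M → q w ≡ false →
                        1 ≤ entries q (u₀ ∷ M ++ [ u₀ ])
  closed-walk-entries q u₀ M {v} {w} v∈ qv w∈ qw with q u₀ in qu₀ | w∈
  ... | false | _          = entries-from-outside q (M ++ [ u₀ ]) qu₀ (∈-rotate M [ u₀ ] v∈) qv
  ... | true  | here refl  = case trans (sym qw) qu₀ of λ ()
  ... | true  | there w∈M with ∈-∃++ w∈M
  ...   | pre , post , refl =
    ≤-trans (entries-from-outside q (post ++ [ u₀ ]) qw (∈-++⁺ʳ post (here refl)) qu₀)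
            (subst (λ l → entries q (w ∷ post ++ [ u₀ ]) ≤ entries q (u₀ ∷ l))
                   (sym (++-assoc pre (w ∷ post) [ u₀ ]))
                   (entries-++ q (u₀ ∷ pre) (w ∷ post ++ [ u₀ ])))

module CyclicScan {A : Set} (marked : A → Bool) (cost : A → A → ℕ)
  (Good : List A → Set)
  (Good-rotate : ∀ xs ys → Good (xs ++ ys) → Good (ys ++ xs))
  (gap : ∀ u seg v rest → Good (u ∷ seg ++ v ∷ rest) →
         marked u ≡ true → marked v ≡ true → cost u v ≤ suc (length seg))
  where

  private
    length-shift : ∀ seg (v : A) (rest : List A) → length (seg ++ [ v ]) + length rest ≡ length seg + suc (length rest)
    length-shift seg v rest = trans (cong (_+ length rest) (length-++ seg)) (+-assoc (length seg) 1 (length rest))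

    -- u is the marked vertex met last, seg the vertices met since, rest those still to be scanned.
    scan : ∀ {u₀} pre u seg rest → Good (u₀ ∷ pre ++ u ∷ seg ++ rest) → marked u₀ ≡ true → marked u ≡ true →
           adjacentSum cost (u ∷ filterᵇ marked rest ++ [ u₀ ]) ≤ suc (length seg + length rest)
    scan {u₀} pre u seg [] good m₀ mu = begin
      cost u u₀ + 0          ≡⟨ +-identityʳ _ ⟩
      cost u u₀              ≤⟨ gap u seg u₀ pre wrapped mu m₀ ⟩
      suc (length seg)       ≡⟨ cong suc (+-identityʳ _) ⟨
      suc (length seg + 0)   ∎
      where
      open ≤-Reasoning
      wrapped : Good (u ∷ seg ++ u₀ ∷ pre)
      wrapped = Good-rotate (u₀ ∷ pre) (u ∷ seg) (subst (λ l → Good (u₀ ∷ pre ++ u ∷ l)) (++-identityʳ seg) good)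
    scan {u₀} pre u seg (v ∷ rest) good m₀ mu with marked v in mv
    ... | true  = +-mono-≤ (gap u seg v (rest ++ u₀ ∷ pre) rotated mu mv) (scan (pre ++ u ∷ seg) v [] rest shifted m₀ mv)
      where
      rotated : Good (u ∷ seg ++ v ∷ rest ++ u₀ ∷ pre)
      rotated = subst (λ l → Good (u ∷ l)) (++-assoc seg (v ∷ rest) (u₀ ∷ pre))
                  (Good-rotate (u₀ ∷ pre) (u ∷ seg ++ v ∷ rest) good)
      shifted : Good (u₀ ∷ (pre ++ u ∷ seg) ++ v ∷ rest)
      shifted = subst (λ l → Good (u₀ ∷ l)) (sym (++-assoc pre (u ∷ seg) (v ∷ rest))) good
    ... | false = ≤-trans (scan pre u (seg ++ [ v ]) rest extended m₀ mu) (≤-reflexive (cong suc (length-shift seg v rest)))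
      where
      extended : Good (u₀ ∷ pre ++ u ∷ (seg ++ [ v ]) ++ rest)
      extended = subst (λ l → Good (u₀ ∷ pre ++ u ∷ l)) (sym (++-assoc seg [ v ] rest)) good

    scan-from : ∀ u₀ seg rest → Good (u₀ ∷ seg ++ rest) → marked u₀ ≡ true → Any (λ v → marked v ≡ true) rest →
                adjacentSum cost (u₀ ∷ filterᵇ marked rest ++ [ u₀ ]) ≤ suc (length seg + length rest)
    scan-from u₀ seg (v ∷ rest) good m₀ some with marked v in mv | some
    ... | true  | _ = +-mono-≤ (gap u₀ seg v rest good m₀ mv) (scan seg v [] rest good m₀ mv)
    ... | false | here mv′    = case trans (sym mv′) mv of λ ()
    ... | false | there some′ = ≤-trans (scan-from u₀ (seg ++ [ v ]) rest extended m₀ some′)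
                                      (≤-reflexive (cong suc (length-shift seg v rest)))
      where
      extended : Good (u₀ ∷ (seg ++ [ v ]) ++ rest)
      extended = subst (λ l → Good (u₀ ∷ l)) (sym (++-assoc seg [ v ] rest)) good

  closed-walk-cost : ∀ u₀ rest → Good (u₀ ∷ rest) → marked u₀ ≡ true → Any (λ v → marked v ≡ true) rest →
                     adjacentSum cost (u₀ ∷ filterᵇ marked rest ++ [ u₀ ]) ≤ length (u₀ ∷ rest)
  closed-walk-cost u₀ rest = scan-from u₀ [] rest

CircumferenceBounds : (k δ p σ₁ σ₂ : ℕ) → Set
CircumferenceBounds k δ p σ₁ σ₂ =
  (p ≡ 1 → (3 * δ + (σ₁ ⊔ σ₂) ∸ 1 ≤ k) × (3 * δ ≤ 3 * δ + (σ₁ ⊔ σ₂) ∸ 1))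
  × (2 ≤ p → (2 * p + 8 ≤ k) × (4 * δ ∸ 2 * p ≤ k))

CircumferenceBounds-swap : ∀ {k δ p σ₁ σ₂} → CircumferenceBounds k δ p σ₂ σ₁ → CircumferenceBounds k δ p σ₁ σ₂
CircumferenceBounds-swap {σ₁ = σ₁} {σ₂} bounds rewrite ⊔-comm σ₁ σ₂ = bounds

m≤m+n∸1 : ∀ m {n} → 1 ≤ n → m ≤ m + n ∸ 1
m≤m+n∸1 m {suc n} _ = subst (λ t → m ≤ t ∸ 1) (sym (+-suc m n)) (m≤m+n m n)

≤-by-slack : ∀ {m n} d → m + d ≡ n → m ≤ n
≤-by-slack {m} d eq = subst (m ≤_) eq (m≤m+n m d)

2*m+2*p≤p*m+4 : ∀ {p m} → 2 ≤ p → 2 ≤ m → 2 * m + 2 * p ≤ p * m + 4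
2*m+2*p≤p*m+4 2≤p 2≤m with m≤n⇒∃[o]m+o≡n 2≤p | m≤n⇒∃[o]m+o≡n 2≤m
... | a , refl | b , refl = ≤-by-slack (a * b)
  (solve 2 (λ a b → con 2 :* (con 2 :+ b) :+ con 2 :* (con 2 :+ a) :+ a :* b
                    := (con 2 :+ a) :* (con 2 :+ b) :+ con 4) refl a b)

positive : ∀ {a b} → b ≤ a → ¬ (a ≡ 0 × b ≡ 0) → 1 ≤ a
positive {zero}  z≤n nonzero = ⊥-elim (nonzero (refl , refl))
positive {suc _} _   _       = s≤s z≤n

entries-surplus : ∀ {α β tA tB} → β ≤ α → 1 ≤ α → 1 ≤ tA → (1 ≤ β → 1 ≤ tB) → β + 2 ≤ α + (tA + tB)
entries-surplus {β = zero}  _   1≤α 1≤tA _    = +-mono-≤ 1≤α (≤-trans 1≤tA (m≤m+n _ _))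
entries-surplus {β = suc _} β≤α _   1≤tA entB = +-mono-≤ β≤α (+-mono-≤ 1≤tA (entB (s≤s z≤n)))

two≤s+entries : ∀ {s β tA tB} → 2 ≤ s + β → 1 ≤ tA → (1 ≤ β → 1 ≤ tB) → 2 ≤ s + (tA + tB)
two≤s+entries {s} {zero}  2≤s  _    _    = ≤-trans 2≤s (+-monoʳ-≤ s z≤n)
two≤s+entries {s} {suc _} _    1≤tA entB = ≤-trans (+-mono-≤ 1≤tA (entB (s≤s z≤n))) (m≤n+m _ s)

-- The degree bound of the endpoint with fewer private neighbours is the one that is used.
bounds-ordered : ∀ {k δ p s α β τ} → β ≤ α → 1 ≤ α →
  2 * (s + α + β) + p * (s + τ) ≤ k → δ ≤ s + β + p → 2 ≤ s + β →
  β + 2 ≤ α + τ → 2 ≤ s + τ → CircumferenceBounds k δ p α β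
bounds-ordered {k} {δ} {p} {s} {α} {β} {τ} β≤α 1≤α walk δ≤ 2≤s+β surplus 2≤s+τ
  rewrite m≥n⇒m⊔n≡m β≤α = short , long
  where
  short : p ≡ 1 → (3 * δ + α ∸ 1 ≤ k) × (3 * δ ≤ 3 * δ + α ∸ 1)
  short refl = m≤n+o⇒m∸n≤o (3 * δ + α) 1 (≤-trans (+-monoˡ-≤ α (*-monoʳ-≤ 3 δ≤)) cancelled)
             , m≤m+n∸1 (3 * δ) 1≤α
    where
    cancelled : 3 * (s + β + 1) + α ≤ 1 + k
    cancelled = +-cancelʳ-≤ (α + τ) _ _ (subst₂ _≤_
      (solve 4 (λ s α β τ → con 1 :+ ((β :+ con 2) :+ (con 2 :* (s :+ α :+ β) :+ con 1 :* (s :+ τ)))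
                           := (con 3 :* (s :+ β :+ con 1) :+ α) :+ (α :+ τ)) refl s α β τ)
      (solve 3 (λ α τ k → con 1 :+ ((α :+ τ) :+ k) := (con 1 :+ k) :+ (α :+ τ)) refl α τ k)
      (s≤s (+-mono-≤ surplus walk)))

  long : 2 ≤ p → (2 * p + 8 ≤ k) × (4 * δ ∸ 2 * p ≤ k)
  long 2≤p = eight , m≤n+o⇒m∸n≤o (4 * δ) (2 * p) (≤-trans (*-monoʳ-≤ 4 δ≤) degrees)
    where
    combined : 2 * (s + α + β) + p * (s + τ) + (2 * (s + τ) + 2 * p) + 2 * (β + 2)
               ≤ k + (p * (s + τ) + 4) + 2 * (α + τ)
    combined = +-mono-≤ (+-mono-≤ walk (2*m+2*p≤p*m+4 2≤p 2≤s+τ)) (*-monoʳ-≤ 2 surplus)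

    eight : 2 * p + 8 ≤ k
    eight = +-cancelʳ-≤ (p * (s + τ) + 4 + 2 * (α + τ) + 4 * (s + β)) _ _ (subst₂ _≤_
      (solve 5 (λ s α β τ p → con 2 :* (s :+ α :+ β) :+ p :* (s :+ τ) :+ (con 2 :* (s :+ τ) :+ con 2 :* p)
                              :+ con 2 :* (β :+ con 2) :+ con 4 :* con 2
                              := (con 2 :* p :+ con 8) :+ (p :* (s :+ τ) :+ con 4 :+ con 2 :* (α :+ τ) :+ con 4 :* (s :+ β)))
             refl s α β τ p)
      (solve 6 (λ s α β τ p k → k :+ (p :* (s :+ τ) :+ con 4) :+ con 2 :* (α :+ τ) :+ con 4 :* (s :+ β)
                                := k :+ (p :* (s :+ τ) :+ con 4 :+ con 2 :* (α :+ τ) :+ con 4 :* (s :+ β)))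
             refl s α β τ p k)
      (+-mono-≤ combined (*-monoʳ-≤ 4 2≤s+β)))

    degrees : 4 * (s + β + p) ≤ 2 * p + k
    degrees = +-cancelʳ-≤ (p * (s + τ) + 4 + 2 * (α + τ)) _ _ (subst₂ _≤_
      (solve 5 (λ s α β τ p → con 2 :* p :+ (con 2 :* (s :+ α :+ β) :+ p :* (s :+ τ) :+ (con 2 :* (s :+ τ) :+ con 2 :* p)
                                             :+ con 2 :* (β :+ con 2))
                              := con 4 :* (s :+ β :+ p) :+ (p :* (s :+ τ) :+ con 4 :+ con 2 :* (α :+ τ)))
             refl s α β τ p)
      (solve 5 (λ s α τ p k → con 2 :* p :+ (k :+ (p :* (s :+ τ) :+ con 4) :+ con 2 :* (α :+ τ))
                              := (con 2 :* p :+ k) :+ (p :* (s :+ τ) :+ con 4 :+ con 2 :* (α :+ τ)))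
             refl s α τ p k)
      (+-monoʳ-≤ (2 * p) combined))

circumference-bounds : ∀ {k δ p s α β tA tB} →
  2 * (s + α + β) + p * (s + (tA + tB)) ≤ k →
  δ ≤ s + α + p → δ ≤ s + β + p → 2 ≤ s + α → 2 ≤ s + β →
  (1 ≤ α → 1 ≤ tA) → (1 ≤ β → 1 ≤ tB) → ¬ (α ≡ 0 × β ≡ 0) →
  CircumferenceBounds k δ p α β
circumference-bounds {k} {δ} {p} {s} {α} {β} {tA} {tB} walk δ≤x δ≤y 2≤x 2≤y entA entB nonzero
  with ≤-total β α
... | inj₁ β≤α = bounds-ordered β≤α 1≤α walk δ≤y 2≤y
                   (entries-surplus β≤α 1≤α (entA 1≤α) entB) (two≤s+entries 2≤y (entA 1≤α) entB)
  where
  1≤α : 1 ≤ α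
  1≤α = positive β≤α nonzero
... | inj₂ α≤β = CircumferenceBounds-swap {k} {δ} {p} {α} {β} (bounds-ordered α≤β 1≤β walk′ δ≤x 2≤x
                   (entries-surplus α≤β 1≤β (entB 1≤β) entA) (two≤s+entries 2≤x (entB 1≤β) entA))
  where
  1≤β : 1 ≤ β
  1≤β = positive α≤β (nonzero ∘ swap)
  walk′ : 2 * (s + β + α) + p * (s + (tB + tA)) ≤ k
  walk′ = subst₂ (λ a b → 2 * a + p * (s + b) ≤ k) (xy∙z≈xz∙y s α β) (+-comm tA tB) walk

lastOf-∷ʳ : ∀ {n} (v : Fin n) vs w → lastOf v (vs ++ [ w ]) ≡ w
lastOf-∷ʳ v []        w = refl
lastOf-∷ʳ v (v′ ∷ vs) w = lastOf-∷ʳ v′ vs w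

module CyclesAndPaths {n : ℕ} (G : Graph n) where

  open import Data.List.Membership.DecPropositional (Fin._≟_ {n}) using (_∈?_)

  Edge-sym : ∀ {u v} → Edge G u v → Edge G v u
  Edge-sym {u} {v} e = trans (Graph.sym G v u) e

  Chain-++⁻ : ∀ xs {y} ys → Chain G (xs ++ y ∷ ys) → Chain G (xs ++ [ y ]) × Chain G (y ∷ ys)
  Chain-++⁻ []            ys c       = tt , c
  Chain-++⁻ (x ∷ [])      ys (e , c) = (e , tt) , c
  Chain-++⁻ (x ∷ x′ ∷ xs) ys (e , c) with Chain-++⁻ (x′ ∷ xs) ys c
  ... | c₁ , c₂ = (e , c₁) , c₂

  Chain-++⁺ : ∀ xs {y} ys → Chain G (xs ++ [ y ]) → Chain G (y ∷ ys) → Chain G (xs ++ y ∷ ys)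
  Chain-++⁺ []            ys _        c = c
  Chain-++⁺ (x ∷ [])      ys (e , _)  c = e , c
  Chain-++⁺ (x ∷ x′ ∷ xs) ys (e , c₁) c = e , Chain-++⁺ (x′ ∷ xs) ys c₁ c

  Chain-∷ʳ⁺ : ∀ v vs {w} → Chain G (v ∷ vs) → Edge G (lastOf v vs) w → Chain G (v ∷ vs ++ [ w ])
  Chain-∷ʳ⁺ v []        c       e = e , tt
  Chain-∷ʳ⁺ v (v′ ∷ vs) (e₁ , c) e = e₁ , Chain-∷ʳ⁺ v′ vs c e

  Chain-∷ʳ⁻ : ∀ v vs {w} → Chain G (v ∷ vs ++ [ w ]) → Chain G (v ∷ vs) × Edge G (lastOf v vs) w
  Chain-∷ʳ⁻ v []        (e , _)  = tt , e
  Chain-∷ʳ⁻ v (v′ ∷ vs) (e₁ , c) with Chain-∷ʳ⁻ v′ vs c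
  ... | c′ , e = (e₁ , c′) , e

  closed-walk : ∀ v vs → IsCycle G (v ∷ vs) → Chain G (v ∷ vs ++ [ v ])
  closed-walk v vs (_ , _ , c , e) = Chain-∷ʳ⁺ v vs c e

  IsCycle-rotate : ∀ xs ys → IsCycle G (xs ++ ys) → IsCycle G (ys ++ xs)
  IsCycle-rotate [] ys cyc = subst (IsCycle G) (sym (++-identityʳ ys)) cyc
  IsCycle-rotate (x ∷ xs) [] cyc = subst (IsCycle G) (++-identityʳ (x ∷ xs)) cyc
  IsCycle-rotate (x ∷ xs) (y ∷ ys) cyc@(3≤ , u , _) =
    subst (3 ≤_) (sym (length-rotate (x ∷ xs) (y ∷ ys))) 3≤
    , Unique-rotate (x ∷ xs) (y ∷ ys) u
    , Chain-∷ʳ⁻ y (ys ++ x ∷ xs) walk′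
    where
    walk : Chain G ((x ∷ xs) ++ y ∷ (ys ++ [ x ]))
    walk = subst (λ l → Chain G (x ∷ l)) (++-assoc xs (y ∷ ys) [ x ]) (closed-walk x (xs ++ y ∷ ys) cyc)
    walk′ : Chain G (y ∷ (ys ++ x ∷ xs) ++ [ y ])
    walk′ with Chain-++⁻ (x ∷ xs) (ys ++ [ x ]) walk
    ... | front , back = subst (λ l → Chain G (y ∷ l)) (sym (++-assoc ys (x ∷ xs) [ y ]))
                           (Chain-++⁺ (y ∷ ys) (xs ++ [ y ]) back front)

  IsCycle-splice : ∀ u seg v rest a qs → IsCycle G (u ∷ seg ++ v ∷ rest) → IsPath G (a ∷ qs) →
    All (_∉ u ∷ seg ++ v ∷ rest) (a ∷ qs) → Edge G u a → Edge G (lastOf a qs) v →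
    IsCycle G (u ∷ (a ∷ qs) ++ v ∷ rest)
  IsCycle-splice u seg v rest a qs cyc@(_ , u∉ ∷ u′ , _) (uQ , cQ) outside e₁ e₂ =
    3≤ , unique , Chain-∷ʳ⁻ u ((a ∷ qs) ++ v ∷ rest) walk′
    where
    3≤ : 3 ≤ length (u ∷ (a ∷ qs) ++ v ∷ rest)
    3≤ = s≤s (s≤s (subst (1 ≤_) (sym (length-++ qs)) (≤-trans (s≤s z≤n) (m≤n+m (suc (length rest)) (length qs)))))
    unique : Unique (u ∷ (a ∷ qs) ++ v ∷ rest)
    unique = All.++⁺ (All.map (λ q∉ u≡q → q∉ (here (sym u≡q))) outside) (All.++⁻ʳ seg u∉)
           ∷ Unique.++⁺ uQ (proj₁ (proj₂ (Unique-++⁻ seg u′)))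
               (λ (z∈Q , z∈rest) → lookup outside z∈Q (there (∈-++⁺ʳ seg z∈rest)))
    walk : Chain G ((u ∷ seg) ++ v ∷ (rest ++ [ u ]))
    walk = subst (λ l → Chain G (u ∷ l)) (++-assoc seg (v ∷ rest) [ u ]) (closed-walk u (seg ++ v ∷ rest) cyc)
    walk′ : Chain G (u ∷ ((a ∷ qs) ++ v ∷ rest) ++ [ u ])
    walk′ = subst (λ l → Chain G (u ∷ l)) (sym (++-assoc (a ∷ qs) (v ∷ rest) [ u ]))
              (Chain-++⁺ (u ∷ a ∷ qs) (rest ++ [ u ]) (e₁ , Chain-∷ʳ⁺ a qs cQ e₂)
                         (proj₂ (Chain-++⁻ (u ∷ seg) (rest ++ [ u ]) walk)))

  record Reversal (x : Fin n) (ps : List (Fin n)) : Set where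
    field
      rest    : List (Fin n)
      ends-at : lastOf (lastOf x ps) rest ≡ x
      length≡ : length rest ≡ length ps
      path    : IsPath G (lastOf x ps ∷ rest)
      ⊆-path  : ∀ {z} → z ∈ lastOf x ps ∷ rest → z ∈ x ∷ ps

  reverse-path : ∀ x ps → IsPath G (x ∷ ps) → Reversal x ps
  reverse-path x [] _ = record { rest = [] ; ends-at = refl ; length≡ = refl ; path = [] ∷ [] , tt ; ⊆-path = λ z∈ → z∈ }
  reverse-path x (p ∷ ps) (x∉ ∷ u , e , c) = record
    { rest    = rest ++ [ x ]
    ; ends-at = lastOf-∷ʳ _ rest x
    ; length≡ = trans (length-++ rest) (trans (+-comm (length rest) 1) (cong suc length≡))
    ; path    = Unique.++⁺ (proj₁ path) ([] ∷ []) (λ where (z∈ , here z≡x) → lookup x∉ (⊆-path z∈) (sym z≡x))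
              , Chain-∷ʳ⁺ _ rest (proj₂ path) (subst (λ v → Edge G v x) (sym ends-at) (Edge-sym e))
    ; ⊆-path  = λ z∈ → case ∈-++⁻ (_ ∷ rest) z∈ of λ where
        (inj₁ z∈rev)       → there (⊆-path z∈rev)
        (inj₂ (here refl)) → here refl
    }
    where open Reversal (reverse-path p ps (u , c))

  module _ (C : List (Fin n)) {a : Fin n} {qs : List (Fin n)}
           (P : IsPathOutside G C (a ∷ qs)) (longestP : ∀ Q → IsPathOutside G C Q → length Q ≤ length (a ∷ qs)) where

    -- Otherwise the path could be prolonged by z.
    neighbour-on-C-or-path : ∀ {z} → Edge G a z → z ∈ C ⊎ z ∈ qs
    neighbour-on-C-or-path {z} e with z ∈? C | z ∈? (a ∷ qs)
    ... | yes z∈C | _               = inj₁ z∈C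
    ... | no _    | yes (there z∈qs) = inj₂ z∈qs
    ... | no _    | yes (here refl)  = case trans (sym e) (Graph.irrefl G a) of λ ()
    ... | no z∉C  | no z∉P           = ⊥-elim (<-irrefl refl (longestP (z ∷ a ∷ qs) prolonged))
      where
      prolonged : IsPathOutside G C (z ∷ a ∷ qs)
      prolonged = (All.¬Any⇒All¬ (a ∷ qs) z∉P ∷ proj₁ (proj₁ P) , Edge-sym e , proj₂ (proj₁ P)) , z∉C ∷ proj₂ P

    degree-bound : deg G a ≤ countB (adj G a) C + length qs
    degree-bound = begin
      countB (adj G a) (allFin n)             ≤⟨ countB-mono (adj G a) (allFin n) (C ++ qs) (Unique.allFin⁺ n) neighbours ⟩
      countB (adj G a) (C ++ qs)              ≡⟨ countB-++ (adj G a) C qs ⟩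
      countB (adj G a) C + countB (adj G a) qs ≤⟨ +-monoʳ-≤ (countB (adj G a) C) (countB≤length (adj G a) qs) ⟩
      countB (adj G a) C + length qs          ∎
      where
      open ≤-Reasoning
      neighbours : ∀ {z} → z ∈ allFin n → Edge G a z → z ∈ C ++ qs
      neighbours _ e = [ ∈-++⁺ˡ , ∈-++⁺ʳ C ]′ (neighbour-on-C-or-path e)

module LongestCycle {n : ℕ} (G : Graph n) (C : List (Fin n)) (cyc : IsCycle G C)
  (longest : ∀ C′ → IsCycle G C′ → length C′ ≤ length C)
  (x : Fin n) (ps : List (Fin n)) (P : IsPathOutside G C (x ∷ ps))
  (longestP : ∀ Q → IsPathOutside G C Q → length Q ≤ length (x ∷ ps))
  (cx : 2 ≤ countB (adj G x) C) (cy : 2 ≤ countB (adj G (lastOf x ps)) C) where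

  open CyclesAndPaths G

  y : Fin n
  y = lastOf x ps

  p : ℕ
  p = length ps

  adjX adjY marked both onlyX onlyY : Fin n → Bool
  adjX v   = adj G x v
  adjY v   = adj G y v
  marked v = adjX v ∨ adjY v
  both v   = adjX v ∧ adjY v
  onlyX v  = adjX v ∧ not (adjY v)
  onlyY v  = adjY v ∧ not (adjX v)

  crossing : Fin n → Fin n → Bool
  crossing u v = (adjX u ∧ adjY v) ∨ (adjY u ∧ adjX v)

  -- The arc of C from u to v is at least this long: P is a detour for a crossing pair, and x or y for any other pair.
  cost : Fin n → Fin n → ℕ
  cost u v = 2 + p * boolToℕ (crossing u v)

  x-marked : ∀ {v} → adjX v ≡ true → marked v ≡ true
  x-marked xv rewrite xv = refl

  y-marked : ∀ {v} → adjY v ≡ true → marked v ≡ true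
  y-marked {v} yv rewrite yv = ∨-zeroʳ (adjX v)

  x-count : countB adjX C ≡ countB both C + countB onlyX C
  x-count = countB-split adjX both onlyX (λ v → boolToℕ-∧-split (adjX v) (adjY v)) C

  y-count : countB adjY C ≡ countB both C + countB onlyY C
  y-count = countB-split adjY both onlyY
    (λ v → trans (boolToℕ-∧-split (adjY v) (adjX v))
                 (cong (λ b → boolToℕ b + boolToℕ (onlyY v)) (∧-comm (adjY v) (adjX v)))) C

  marked-count : countB marked C ≡ countB adjX C + countB onlyY C
  marked-count = countB-split marked adjX onlyY (λ v → boolToℕ-∨-split (adjX v) (adjY v)) C

  CycleOnC : List (Fin n) → Set
  CycleOnC D = IsCycle G D × length D ≡ length C × (∀ {z} → z ∈ D → z ∈ C)

  CycleOnC-rotate : ∀ xs ys → CycleOnC (xs ++ ys) → CycleOnC (ys ++ xs)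
  CycleOnC-rotate xs ys (cycle , len , ⊆C) = IsCycle-rotate xs ys cycle , trans (length-rotate xs ys) len , ⊆C ∘ ∈-rotate xs ys

  detour-bound : ∀ {u seg v rest a qs} → CycleOnC (u ∷ seg ++ v ∷ rest) → IsPathOutside G C (a ∷ qs) →
                 Edge G u a → Edge G (lastOf a qs) v → length (a ∷ qs) ≤ length seg
  detour-bound {u} {seg} {v} {rest} {a} {qs} (cycle , len , ⊆C) (path , outside) e₁ e₂ =
    +-cancelʳ-≤ (length (v ∷ rest)) _ _ (subst₂ _≤_ (length-++ (a ∷ qs)) (length-++ seg) (s≤s⁻¹ detour≤C))
    where
    detour≤C : length (u ∷ (a ∷ qs) ++ v ∷ rest) ≤ length (u ∷ seg ++ v ∷ rest)
    detour≤C = subst (_ ≤_) (sym len)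
      (longest _ (IsCycle-splice u seg v rest a qs cycle path (All.map (λ z∉C → z∉C ∘ ⊆C) outside) e₁ e₂))

  P⁻¹ : Reversal x ps
  P⁻¹ = reverse-path x ps (proj₁ P)

  module P⁻¹ = Reversal P⁻¹

  P⁻¹-outside : IsPathOutside G C (y ∷ P⁻¹.rest)
  P⁻¹-outside = P⁻¹.path , All.tabulate (lookup (proj₂ P) ∘ P⁻¹.⊆-path)

  P⁻¹-longest : ∀ Q → IsPathOutside G C Q → length Q ≤ length (y ∷ P⁻¹.rest)
  P⁻¹-longest Q Q-outside = subst (length Q ≤_) (cong suc (sym P⁻¹.length≡)) (longestP Q Q-outside)

  x-outside : IsPathOutside G C [ x ]
  x-outside = ([] ∷ [] , tt) , All.head (proj₂ P) ∷ []

  y-outside : IsPathOutside G C [ y ]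
  y-outside = ([] ∷ [] , tt) , All.head (proj₂ P⁻¹-outside) ∷ []

  crossing-gap : ∀ {u seg v rest} → CycleOnC (u ∷ seg ++ v ∷ rest) → crossing u v ≡ true → suc p ≤ length seg
  crossing-gap {u} {seg} {v} D cross with ∨-∧-cases (adjX u) (adjY v) (adjY u) (adjX v) cross
  ... | inj₁ (xu , yv) = detour-bound D P (Edge-sym xu) yv
  ... | inj₂ (yu , xv) = subst (λ m → suc m ≤ length seg) P⁻¹.length≡
                           (detour-bound D P⁻¹-outside (Edge-sym yu) (subst (λ w → Edge G w v) (sym P⁻¹.ends-at) xv))

  marked-gap : ∀ {u seg v rest} → CycleOnC (u ∷ seg ++ v ∷ rest) → marked u ≡ true → marked v ≡ true → 1 ≤ length seg
  marked-gap {u} {seg} {v} D mu mv with ∨-pair-cases (adjX u) (adjY u) (adjX v) (adjY v) mu mv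
  ... | inj₁ (xu , xv)         = detour-bound D x-outside (Edge-sym xu) xv
  ... | inj₂ (inj₁ (yu , yv))  = detour-bound D y-outside (Edge-sym yu) yv
  ... | inj₂ (inj₂ cross)      = ≤-trans (s≤s z≤n) (crossing-gap D cross)

  cost-gap : ∀ u seg v rest → CycleOnC (u ∷ seg ++ v ∷ rest) → marked u ≡ true → marked v ≡ true →
             cost u v ≤ suc (length seg)
  cost-gap u seg v rest D mu mv with crossing u v in cross
  ... | true  = s≤s (subst (λ m → suc m ≤ length seg) (sym (*-identityʳ p)) (crossing-gap D cross))
  ... | false = subst (λ m → 2 + m ≤ suc (length seg)) (sym (*-zeroʳ p)) (s≤s (marked-gap D mu mv))

  open CyclicScan marked cost CycleOnC CycleOnC-rotate cost-gap

  start : ∃ λ u₀ → u₀ ∈ C × adjX u₀ ≡ true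
  start = find (countB-witness adjX C (≤-trans (s≤s z≤n) cx))

  u₀ : Fin n
  u₀ = proj₁ start

  m₀ : marked u₀ ≡ true
  m₀ = x-marked (proj₂ (proj₂ start))

  C-split : ∃₂ λ X Y → C ≡ X ++ [ u₀ ] ++ Y
  C-split = ∈-∃++ (proj₁ (proj₂ start))

  X Y R : List (Fin n)
  X = proj₁ C-split
  Y = proj₁ (proj₂ C-split)
  R = Y ++ X

  C≡ : C ≡ X ++ u₀ ∷ Y
  C≡ = proj₂ (proj₂ C-split)

  C-from-u₀ : CycleOnC (u₀ ∷ R)
  C-from-u₀ = CycleOnC-rotate X (u₀ ∷ Y) (subst CycleOnC C≡ (cyc , refl , λ z∈ → z∈))

  countB-from-u₀ : ∀ q → countB q (u₀ ∷ R) ≡ countB q C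
  countB-from-u₀ q = trans (countB-rotate q X (u₀ ∷ Y)) (cong (countB q) (sym C≡))

  walk : List (Fin n)
  walk = u₀ ∷ filterᵇ marked R ++ [ u₀ ]

  walk-cost : adjacentSum cost walk ≤ length C
  walk-cost = subst (adjacentSum cost walk ≤_) (proj₁ (proj₂ C-from-u₀)) (closed-walk-cost u₀ R C-from-u₀ m₀ marked-in-R)
    where
    2≤marked : 2 ≤ countB marked (u₀ ∷ R)
    2≤marked = subst (2 ≤_) (trans (sym marked-count) (sym (countB-from-u₀ marked))) (≤-trans cx (m≤m+n _ _))
    marked-in-R : Any (λ v → marked v ≡ true) R
    marked-in-R = countB-witness marked R
      (s≤s⁻¹ (subst (2 ≤_) (trans (countB-∷ marked u₀ R) (cong (λ b → boolToℕ b + countB marked R) m₀)) 2≤marked))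

  walk-countB : ∀ q → (∀ {v} → q v ≡ true → marked v ≡ true) → countB q (filterᵇ marked R ++ [ u₀ ]) ≡ countB q C
  walk-countB q q⇒marked = begin
    countB q (filterᵇ marked R ++ [ u₀ ])          ≡⟨ countB-++ q (filterᵇ marked R) [ u₀ ] ⟩
    countB q (filterᵇ marked R) + countB q [ u₀ ]  ≡⟨ cong (_+ countB q [ u₀ ]) (countB-filterᵇ q marked q⇒marked R) ⟩
    countB q R + countB q [ u₀ ]                   ≡⟨ countB-++ q R [ u₀ ] ⟨
    countB q (R ++ [ u₀ ])                         ≡⟨ countB-rotate q [ u₀ ] R ⟩
    countB q (u₀ ∷ R)                              ≡⟨ countB-from-u₀ q ⟩
    countB q C                                     ∎
    where open ≡-Reasoning

  on-walk : ∀ {v} → v ∈ C → marked v ≡ true → v ∈ u₀ ∷ filterᵇ marked R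
  on-walk v∈C mv with ∈-rotate (u₀ ∷ Y) X (subst (_ ∈_) C≡ v∈C)
  ... | here v≡u₀ = here v≡u₀
  ... | there v∈R = there (∈-filterᵇ⁺ marked v∈R mv)

  weighted-walk : ∀ z L → All (λ v → marked v ≡ true) (z ∷ L) →
    2 * length L + p * (countB both L + (entries onlyX (z ∷ L) + entries onlyY (z ∷ L))) ≤ adjacentSum cost (z ∷ L)
  weighted-walk z []       _          = ≤-reflexive (*-zeroʳ p)
  weighted-walk z (z′ ∷ L) (mz ∷ ms) = subst (_≤ adjacentSum cost (z ∷ z′ ∷ L)) (sym regroup)
    (+-mono-≤ (+-monoʳ-≤ 2 (*-monoʳ-≤ p (entry-indicators≤crossing (adjX z) (adjY z) (adjX z′) (adjY z′) mz)))
              (weighted-walk z′ L ms))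
    where
    b eX eY : ℕ
    b = boolToℕ (both z′)
    eX = boolToℕ (not (onlyX z) ∧ onlyX z′)
    eY = boolToℕ (not (onlyY z) ∧ onlyY z′)
    regroup : 2 * length (z′ ∷ L)
              + p * (countB both (z′ ∷ L) + (entries onlyX (z ∷ z′ ∷ L) + entries onlyY (z ∷ z′ ∷ L)))
            ≡ (2 + p * (b + (eX + eY)))
              + (2 * length L + p * (countB both L + (entries onlyX (z′ ∷ L) + entries onlyY (z′ ∷ L))))
    regroup rewrite countB-∷ both z′ L = solve 8 (λ p b eX eY l c tX tY →
      con 2 :* (con 1 :+ l) :+ p :* ((b :+ c) :+ ((eX :+ tX) :+ (eY :+ tY))) :=
      (con 2 :+ p :* (b :+ (eX :+ eY))) :+ (con 2 :* l :+ p :* (c :+ (tX :+ tY))))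
      refl p b eX eY (length L) (countB both L) (entries onlyX (z′ ∷ L)) (entries onlyY (z′ ∷ L))

  walk-bound : 2 * (countB both C + countB onlyX C + countB onlyY C)
               + p * (countB both C + (entries onlyX walk + entries onlyY walk)) ≤ length C
  walk-bound = ≤-trans (subst₂ (λ a b → 2 * a + p * (b + (entries onlyX walk + entries onlyY walk)) ≤ adjacentSum cost walk)
                         walk-length (walk-countB both (x-marked ∘ ∧≡true⇒ˡ _))
                         (weighted-walk u₀ (filterᵇ marked R ++ [ u₀ ]) walk-marked))
                       walk-cost
    where
    walk-marked : All (λ v → marked v ≡ true) walk
    walk-marked = m₀ ∷ All.++⁺ (filterᵇ-All marked R) (m₀ ∷ [])
    walk-length : length (filterᵇ marked R ++ [ u₀ ]) ≡ countB both C + countB onlyX C + countB onlyY C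
    walk-length = begin
      length (filterᵇ marked R ++ [ u₀ ])             ≡⟨ countB-all marked _ (All.tail walk-marked) ⟨
      countB marked (filterᵇ marked R ++ [ u₀ ])      ≡⟨ walk-countB marked (λ mv → mv) ⟩
      countB marked C                                 ≡⟨ marked-count ⟩
      countB adjX C + countB onlyY C                  ≡⟨ cong (_+ countB onlyY C) x-count ⟩
      countB both C + countB onlyX C + countB onlyY C ∎
      where open ≡-Reasoning

  x-entries : 1 ≤ countB onlyX C → 1 ≤ entries onlyX walk
  x-entries 1≤ with find (countB-witness onlyX C 1≤) | find (countB-witness adjY C (≤-trans (s≤s z≤n) cy))
  ... | v , v∈C , xv | w , w∈C , yw = closed-walk-entries onlyX u₀ (filterᵇ marked R)
          (on-walk v∈C (x-marked (∧≡true⇒ˡ _ xv))) xv (on-walk w∈C (y-marked yw)) not-onlyX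
    where
    not-onlyX : onlyX w ≡ false
    not-onlyX rewrite yw = ∧-zeroʳ (adjX w)

  y-entries : 1 ≤ countB onlyY C → 1 ≤ entries onlyY walk
  y-entries 1≤ with find (countB-witness onlyY C 1≤)
  ... | v , v∈C , yv = closed-walk-entries onlyY u₀ (filterᵇ marked R)
          (on-walk v∈C (y-marked (∧≡true⇒ˡ _ yv))) yv (here refl) not-onlyY
    where
    not-onlyY : onlyY u₀ ≡ false
    not-onlyY rewrite proj₂ (proj₂ start) = ∧-zeroʳ (adjY u₀)

  x-degree : deg G x ≤ countB both C + countB onlyX C + p
  x-degree = subst (λ t → deg G x ≤ t + p) x-count (degree-bound C P longestP)

  y-degree : deg G y ≤ countB both C + countB onlyY C + p
  y-degree = subst₂ (λ t l → deg G y ≤ t + l) y-count P⁻¹.length≡ (degree-bound C P⁻¹-outside P⁻¹-longest)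

  private-neighbours : ¬ (∀ v → v ∈ C → adj G x v ≡ adj G y v) → ¬ (countB onlyX C ≡ 0 × countB onlyY C ≡ 0)
  private-neighbours differ (none-x , none-y) = differ λ v v∈C →
    ∧-not-false⇒≡ (adjX v) (adjY v) (countB≡0⇒false onlyX C none-x v∈C) (countB≡0⇒false onlyY C none-y v∈C)

lemma1 : ∀ {n} (G : Graph n) (δ : ℕ) → IsMinDegree G δ →
    (C : List (Fin n)) → IsCycle G C →
    (∀ C′ → IsCycle G C′ → length C′ ≤ length C) →
    (x : Fin n) (ps : List (Fin n)) → IsPathOutside G C (x ∷ ps) →
    (∀ Q → IsPathOutside G C Q → length Q ≤ length (x ∷ ps)) →
    1 ≤ length ps →
    2 ≤ countB (adj G x) C →
    2 ≤ countB (adj G (lastOf x ps)) C →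
    ¬ (∀ v → v ∈ C → adj G x v ≡ adj G (lastOf x ps) v) →
    (length ps ≡ 1 →
      (3 * δ + (countB (λ v → adj G x v ∧ not (adj G (lastOf x ps) v)) C
               ⊔ countB (λ v → adj G (lastOf x ps) v ∧ not (adj G x v)) C) ∸ 1 ≤ length C)
      × (3 * δ ≤ 3 * δ + (countB (λ v → adj G x v ∧ not (adj G (lastOf x ps) v)) C
               ⊔ countB (λ v → adj G (lastOf x ps) v ∧ not (adj G x v)) C) ∸ 1))
    × (2 ≤ length ps →
      (2 * length ps + 8 ≤ length C) × (4 * δ ∸ 2 * length ps ≤ length C))
lemma1 G δ (δ≤deg , _) C cyc longest x ps P longestP _ cx cy differ =
  circumference-bounds walk-bound (≤-trans (δ≤deg x) x-degree) (≤-trans (δ≤deg y) y-degree)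
    (subst (2 ≤_) x-count cx) (subst (2 ≤_) y-count cy) x-entries y-entries (private-neighbours differ)
  where open LongestCycle G C cyc longest x ps P longestP cx cy
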